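{- Let $q$ be an odd prime power and let $E\subset \mathbb{F}_q^2$ be nonempty. Let $K_E:=\max_{u\in \mathbb{F}_q}|E\cap(\{u\}\times\mathbb{F}_q)|$. Then \[ |\Delta_P(E)|\ \ge\ \frac{q}{1+\dfrac{q^2K_E}{|E|^2}}. \] In particular, there exist absolute constants $C,c>0$ (independent of $q$ and $E$) such that if $|E|\ge Cq\sqrt{K_E}$, then $|\Delta_P(E)|\ge cq$.
   Context: For $\mathbf{x}=(x_1,x_2),\mathbf{y}=(y_1,y_2)\in\mathbb{F}_q^2$, the parabolic distance is $\|\mathbf{x}-\mathbf{y}\|_P:=(x_2-y_2)+(x_1-y_1)^2\in\mathbb{F}_q$. For $E\subset\mathbb{F}_q^2$, $\Delta_P(E):=\{\|\mathbf{x}-\mathbf{y}\|_P:\mathbf{x},\mathbf{y}\in E\}$. $K_E$ is the size of the largest vertical slice of $E$. -}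

module Defs where

open import Data.Nat using (ℕ; zero; suc; _+_; _*_; _^_; _≤_; _⊔_)
open import Data.Nat.Primality using (Prime)
open import Data.Fin using (Fin)
open import Data.Fin.Properties using (_≟_)
open import Data.Bool using (Bool; true; false; _∧_; if_then_else_)
open import Data.List using (List; []; _∷_; allFin; filter; length; map; foldr)
open import Data.Bool.ListAction using (any)
open import Data.Product using (Σ; ∃; _×_; _,_)
open import Relation.Binary.PropositionalEquality using (_≡_; _≢_)
open import Relation.Nullary.Decidable using (⌊_⌋)
open import Algebra.Structures using (IsCommutativeRing)

OddPrimePower : ℕ → Set
OddPrimePower q = Σ ℕ λ p → Σ ℕ λ k → Prime p × (Σ ℕ λ m → p ≡ suc (2 * m)) × q ≡ p ^ suc k

-- A field structure on the q-element set Fin q (any finite field of order q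
-- is isomorphic to one of these).
record FiniteField (q : ℕ) : Set where
  field
    _⊕_ _⊗_ : Fin q → Fin q → Fin q
    ⊖_      : Fin q → Fin q
    𝟘 𝟙     : Fin q
    isCommutativeRing : IsCommutativeRing _≡_ _⊕_ _⊗_ ⊖_ 𝟘 𝟙
    𝟘≢𝟙     : 𝟘 ≢ 𝟙
    inverse : (x : Fin q) → x ≢ 𝟘 → Σ (Fin q) λ y → x ⊗ y ≡ 𝟙

Point : ℕ → Set
Point q = Fin q × Fin q

Subset2 : ℕ → Set
Subset2 q = Point q → Bool

module _ {q : ℕ} (F : FiniteField q) where
  open FiniteField F

  parDist : Point q → Point q → Fin q
  parDist (x₁ , x₂) (y₁ , y₂) = (x₂ ⊕ (⊖ y₂)) ⊕ ((x₁ ⊕ (⊖ y₁)) ⊗ (x₁ ⊕ (⊖ y₁)))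

  allPoints : List (Point q)
  allPoints = Data.List.concatMap (λ a → map (λ b → (a , b)) (allFin q)) (allFin q)

  inΔ : Subset2 q → Fin q → Bool
  inΔ E t = any (λ x → any (λ y → E x ∧ E y ∧ ⌊ parDist x y ≟ t ⌋) allPoints) allPoints

  cardΔ : Subset2 q → ℕ
  cardΔ E = length (filter (λ t → inΔ E t ≡? true) (allFin q))
    where
    open import Data.Bool.Properties using () renaming (_≟_ to _≡?_)

card : {q : ℕ} → Subset2 q → ℕ
card {q} E = length (filter (λ x → E x ≡? true) (Data.List.concatMap (λ a → map (λ b → (a , b)) (allFin q)) (allFin q)))
  where open import Data.Bool.Properties using () renaming (_≟_ to _≡?_)

sliceCard : {q : ℕ} → Subset2 q → Fin q → ℕ
sliceCard {q} E u = length (filter (λ v → E (u , v) ≡? true) (allFin q))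
  where open import Data.Bool.Properties using () renaming (_≟_ to _≡?_)

K : {q : ℕ} → Subset2 q → ℕ
K {q} E = foldr _⊔_ 0 (map (sliceCard E) (allFin q))

open import Data.Integer using (+_)
import Data.Rational as ℚ
open ℚ using (ℚ)

ℕ→ℚ : ℕ → ℚ
ℕ→ℚ n = (+ n) ℚ./ 1

module Submission where

-- Let ν(t) count the pairs (x, y) ∈ E² with ‖x − y‖_P = t, so that ∑ₜ ν(t) = |E|².
-- Cauchy–Schwarz on the support Δ_P(E) of ν gives |E|⁴ ≤ |Δ_P(E)| ∑ₜ ν(t)², and
-- q² ∑ₜ ν(t)² = q |E|⁴ + ∑ₜ (q ν(t) − |E|²)², so it suffices to show that the centred
-- second moment is at most q³ K_E |E|². Since ‖x − y‖_P = t iff x₂ + (x₁ − y₁)² = t + y₂,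
-- ν(t) = ∑_{y ∈ E} h(y₁, t + y₂), where h(c, w) counts the points of E on the parabola
-- x₂ + (x₁ − c)² = w. Cauchy–Schwarz in y, translation invariance in t and the slice
-- bound K_E reduce this to ∑_c ∑_w (q h(c, w) − |E|)² ≤ q³ |E|, that is, to
-- ∑_c ∑_w h(c, w)² ≤ |E|² + q |E|. The latter holds because two distinct points lie on a
-- common such parabola for at most one c; this is where q odd (division by 2) is used.

open import Algebra.Bundles using (CommutativeRing)
open import Data.Bool using (Bool; true; false; _∧_)
open import Data.Empty using (⊥-elim)
open import Data.Fin using (Fin; zero; suc)
open import Data.Fin.Properties using (_≟_)
open import Data.Nat using (ℕ)
open import Data.List using (List; _++_; length; filter; tabulate; concat; map; foldr; allFin)
open import Data.Product using (Σ; ∃; _×_; _,_; proj₁; proj₂)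
open import Function using (_∘_)
open import Relation.Binary.PropositionalEquality
open import Relation.Nullary using (Dec; yes; no; does)

open import Defs

module IntegerSums where
  open import Data.Integer as ℤ using (ℤ; +_; 0ℤ; 1ℤ; _+_; _*_; -_; _-_; _≤_)
  import Data.Integer.Properties as ℤ
  open import Data.Integer.Tactic.RingSolver using (solve-∀)
  import Data.Nat as ℕ
  open import Algebra.Properties.Semiring.Sum ℤ.+-*-semiring using (sum; sum-cong-≗; ∑-distrib-+; *-distribˡ-sum; ∑-permute)
  import Data.Nat.Properties as ℕ
  open import Data.Fin.Properties using (suc-injective; 0≢1+n; _<?_; <-cmp; <-asym)
  open import Data.Fin.Permutation using (permutation)
  open import Data.Product.Properties using (,-injective)
  open import Function.Bundles using (_⇔_)
  open import Relation.Binary.Definitions using (DecidableEquality; tri<; tri≈; tri>)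
  open import Relation.Nullary.Decidable using (dec-true; dec-false; does-⇔; map′; _×-dec_)

  infix 8 _²

  _² : ℤ → ℤ
  x ² = x * x

  χ : Bool → ℤ
  χ true  = 1ℤ
  χ false = 0ℤ

  ⟦_⟧ : ∀ {p} {P : Set p} → Dec P → ℤ
  ⟦ d ⟧ = χ (does d)

  0≤χ : ∀ b → 0ℤ ≤ χ b
  0≤χ true  = ℤ.+≤+ ℕ.z≤n
  0≤χ false = ℤ.+≤+ ℕ.z≤n

  χ≤1 : ∀ b → χ b ≤ 1ℤ
  χ≤1 true  = ℤ.≤-refl
  χ≤1 false = ℤ.+≤+ ℕ.z≤n

  χ²≡χ : ∀ b → χ b ² ≡ χ b
  χ²≡χ true  = refl
  χ²≡χ false = refl

  0≤x*y : ∀ {x y} → 0ℤ ≤ x → 0ℤ ≤ y → 0ℤ ≤ x * y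
  0≤x*y {+ m} {+ n} _ _ = subst (0ℤ ≤_) (ℤ.pos-* m n) (ℤ.+≤+ ℕ.z≤n)

  *-monoˡ-≤-0≤ : ∀ {c x y} → 0ℤ ≤ c → x ≤ y → c * x ≤ c * y
  *-monoˡ-≤-0≤ {+ n} _ = ℤ.*-monoˡ-≤-nonNeg (+ n)

  *-monoʳ-≤-0≤ : ∀ {c x y} → 0ℤ ≤ c → x ≤ y → x * c ≤ y * c
  *-monoʳ-≤-0≤ {+ n} _ = ℤ.*-monoʳ-≤-nonNeg (+ n)

  0≤x² : ∀ x → 0ℤ ≤ x ²
  0≤x² (+ n)      = 0≤x*y {+ n} {+ n} (ℤ.+≤+ ℕ.z≤n) (ℤ.+≤+ ℕ.z≤n)
  0≤x² ℤ.-[1+ n ] = ℤ.+≤+ ℕ.z≤n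

  pos-² : ∀ n → + (n ℕ.^ 2) ≡ + n * + n
  pos-² n = trans (cong (λ m → + (n ℕ.* m)) (ℕ.*-identityʳ n)) (ℤ.pos-* n n)

  -- A finite sum abstracted as a monotone linear functional, so that Fubini and
  -- Cauchy–Schwarz serve sums over Fin n and over Fin n × Fin n alike.
  record Summation (I : Set) : Set₁ where
    field
      ∑      : (I → ℤ) → ℤ
      ∑-cong : ∀ {f g} → (∀ i → f i ≡ g i) → ∑ f ≡ ∑ g
      ∑-+    : ∀ f g → ∑ (λ i → f i + g i) ≡ ∑ f + ∑ g
      ∑-*ˡ   : ∀ c f → ∑ (λ i → c * f i) ≡ c * ∑ f
      ∑-mono : ∀ {f g} → (∀ i → f i ≤ g i) → ∑ f ≤ ∑ g

    ∑-0 : ∑ (λ _ → 0ℤ) ≡ 0ℤ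
    ∑-0 = ∑-*ˡ 0ℤ (λ _ → 0ℤ)

    ∑-*ʳ : ∀ c f → ∑ (λ i → f i * c) ≡ ∑ f * c
    ∑-*ʳ c f = trans (∑-cong (λ i → ℤ.*-comm (f i) c)) (trans (∑-*ˡ c f) (ℤ.*-comm c (∑ f)))

    ∑-minus : ∀ f g → ∑ (λ i → f i - g i) ≡ ∑ f - ∑ g
    ∑-minus f g = begin
      ∑ (λ i → f i - g i)           ≡⟨ ∑-+ f (λ i → - g i) ⟩
      ∑ f + ∑ (λ i → - g i)         ≡⟨ cong (λ z → ∑ f + z) (∑-cong (λ i → sym (ℤ.-1*i≡-i (g i)))) ⟩
      ∑ f + ∑ (λ i → - 1ℤ * g i)    ≡⟨ cong (λ z → ∑ f + z) (trans (∑-*ˡ (- 1ℤ) g) (ℤ.-1*i≡-i (∑ g))) ⟩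
      ∑ f - ∑ g                     ∎
      where open ≡-Reasoning

    ∑-linear₃ : ∀ α β γ f g h →
      ∑ (λ i → α * f i + β * g i + γ * h i) ≡ α * ∑ f + β * ∑ g + γ * ∑ h
    ∑-linear₃ α β γ f g h = begin
      ∑ (λ i → α * f i + β * g i + γ * h i)               ≡⟨ ∑-+ _ _ ⟩
      ∑ (λ i → α * f i + β * g i) + ∑ (λ i → γ * h i)     ≡⟨ cong₂ _+_ (∑-+ _ _) (∑-*ˡ γ h) ⟩
      ∑ (λ i → α * f i) + ∑ (λ i → β * g i) + γ * ∑ h
        ≡⟨ cong (λ z → z + γ * ∑ h) (cong₂ _+_ (∑-*ˡ α f) (∑-*ˡ β g)) ⟩
      α * ∑ f + β * ∑ g + γ * ∑ h                         ∎
      where open ≡-Reasoning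

    0≤∑ : ∀ {f} → (∀ i → 0ℤ ≤ f i) → 0ℤ ≤ ∑ f
    0≤∑ {f} 0≤f = subst (_≤ ∑ f) ∑-0 (∑-mono 0≤f)

  sum-mono : ∀ {n} {f g : Fin n → ℤ} → (∀ i → f i ≤ g i) → sum f ≤ sum g
  sum-mono {ℕ.zero}  f≤g = ℤ.≤-refl
  sum-mono {ℕ.suc n} f≤g = ℤ.+-mono-≤ (f≤g zero) (sum-mono (f≤g ∘ suc))

  finSummation : ∀ n → Summation (Fin n)
  finSummation n = record
    { ∑      = sum
    ; ∑-cong = sum-cong-≗
    ; ∑-+    = ∑-distrib-+
    ; ∑-*ˡ   = λ c f → sym (*-distribˡ-sum c f)
    ; ∑-mono = sum-mono
    }

  _⊗ˢ_ : ∀ {A B} → Summation A → Summation B → Summation (A × B)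
  SA ⊗ˢ SB = record
    { ∑      = λ f → A.∑ (λ a → B.∑ (λ b → f (a , b)))
    ; ∑-cong = λ f≗g → A.∑-cong (λ a → B.∑-cong (λ b → f≗g (a , b)))
    ; ∑-+    = λ f g → trans (A.∑-cong (λ a → B.∑-+ _ _)) (A.∑-+ _ _)
    ; ∑-*ˡ   = λ c f → trans (A.∑-cong (λ a → B.∑-*ˡ c _)) (A.∑-*ˡ c _)
    ; ∑-mono = λ f≤g → A.∑-mono (λ a → B.∑-mono (λ b → f≤g (a , b)))
    }
    where
    module A = Summation SA
    module B = Summation SB

  pointSummation : ∀ n → Summation (Fin n × Fin n)
  pointSummation n = finSummation n ⊗ˢ finSummation n

  _≟ₚ_ : ∀ {n} → DecidableEquality (Fin n × Fin n)
  (a , b) ≟ₚ (a' , b') = map′ (λ (a≡a' , b≡b') → cong₂ _,_ a≡a' b≡b') ,-injective ((a ≟ a') ×-dec (b ≟ b'))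

  sum-const : ∀ n c → sum {n} (λ _ → c) ≡ + n * c
  sum-const ℕ.zero    c = refl
  sum-const (ℕ.suc n) c = begin
    c + sum {n} (λ _ → c)  ≡⟨ cong (λ z → c + z) (sum-const n c) ⟩
    c + + n * c            ≡⟨ sym (ℤ.suc-* (+ n) c) ⟩
    + ℕ.suc n * c          ∎
    where open ≡-Reasoning

  sum-reindex : ∀ {n} (σ τ : Fin n → Fin n) → (∀ y → σ (τ y) ≡ y) → (∀ x → τ (σ x) ≡ x) →
    ∀ g → sum (λ x → g (σ x)) ≡ sum g
  sum-reindex σ τ στ τσ g = sym (∑-permute g (permutation σ τ στ τσ))

  sum-⟦≟⟧* : ∀ {n} (u : Fin n) (g : Fin n → ℤ) → sum (λ v → ⟦ u ≟ v ⟧ * g v) ≡ g u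
  sum-⟦≟⟧* {ℕ.suc n} zero g = begin
    1ℤ * g zero + sum (λ v → 0ℤ * g (suc v))
      ≡⟨ cong (λ z → 1ℤ * g zero + z) (Summation.∑-0 (finSummation n)) ⟩
    1ℤ * g zero + 0ℤ                          ≡⟨ trans (ℤ.+-identityʳ _) (ℤ.*-identityˡ _) ⟩
    g zero                                    ∎
    where open ≡-Reasoning
  sum-⟦≟⟧* {ℕ.suc n} (suc u) g = trans (ℤ.+-identityˡ _) (sum-⟦≟⟧* u (g ∘ suc))

  sum-⟦≟⟧ : ∀ {n} (u : Fin n) → sum (λ v → ⟦ u ≟ v ⟧) ≡ 1ℤ
  sum-⟦≟⟧ u = trans (sum-cong-≗ (λ v → sym (ℤ.*-identityʳ ⟦ u ≟ v ⟧))) (sum-⟦≟⟧* u (λ _ → 1ℤ))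

  sum-⟦≟⟧≤1 : ∀ {n m} (u v : Fin n → Fin m) → (∀ i j → u i ≡ v i → u j ≡ v j → i ≡ j) →
    sum (λ i → ⟦ u i ≟ v i ⟧) ≤ 1ℤ
  sum-⟦≟⟧≤1 {ℕ.zero}  u v unique = ℤ.+≤+ ℕ.z≤n
  sum-⟦≟⟧≤1 {ℕ.suc n} u v unique with u zero ≟ v zero
  ... | yes u₀≡v₀ = ℤ.≤-reflexive (cong (λ z → 1ℤ + z) (trans (sum-cong-≗ rest≡0) (Summation.∑-0 (finSummation n))))
    where
    rest≡0 : ∀ i → ⟦ u (suc i) ≟ v (suc i) ⟧ ≡ 0ℤ
    rest≡0 i with u (suc i) ≟ v (suc i)
    ... | yes uᵢ≡vᵢ = ⊥-elim (0≢1+n (unique zero (suc i) u₀≡v₀ uᵢ≡vᵢ))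
    ... | no _ = refl
  ... | no _ = ℤ.≤-trans (ℤ.≤-reflexive (ℤ.+-identityˡ _))
                         (sum-⟦≟⟧≤1 (u ∘ suc) (v ∘ suc) (λ i j p r → suc-injective (unique (suc i) (suc j) p r)))

  χ-∧ : ∀ b b' → χ (b ∧ b') ≡ χ b * χ b'
  χ-∧ true  b' = sym (ℤ.*-identityˡ (χ b'))
  χ-∧ false b' = refl

  ⟦⟧-cong : ∀ {a b} {A : Set a} {B : Set b} → A ⇔ B → (a? : Dec A) (b? : Dec B) → ⟦ a? ⟧ ≡ ⟦ b? ⟧
  ⟦⟧-cong A⇔B a? b? = cong χ (does-⇔ A⇔B a? b?)

  ∑ₚ-⟦≟ₚ⟧* : ∀ {n} (x : Fin n × Fin n) (g : Fin n × Fin n → ℤ) →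
    Summation.∑ (pointSummation n) (λ x' → ⟦ x ≟ₚ x' ⟧ * g x') ≡ g x
  ∑ₚ-⟦≟ₚ⟧* {n} (a , b) g = begin
    sum (λ a' → sum (λ b' → χ (does (a ≟ a') ∧ does (b ≟ b')) * g (a' , b')))
      ≡⟨ sum-cong-≗ (λ a' → sum-cong-≗ (split a')) ⟩
    sum (λ a' → sum (λ b' → ⟦ a ≟ a' ⟧ * (⟦ b ≟ b' ⟧ * g (a' , b'))))
      ≡⟨ sum-cong-≗ (λ a' → sym (*-distribˡ-sum ⟦ a ≟ a' ⟧ (λ b' → ⟦ b ≟ b' ⟧ * g (a' , b')))) ⟩
    sum (λ a' → ⟦ a ≟ a' ⟧ * sum (λ b' → ⟦ b ≟ b' ⟧ * g (a' , b')))
      ≡⟨ sum-cong-≗ (λ a' → cong (⟦ a ≟ a' ⟧ *_) (sum-⟦≟⟧* b (λ b' → g (a' , b')))) ⟩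
    sum (λ a' → ⟦ a ≟ a' ⟧ * g (a' , b))  ≡⟨ sum-⟦≟⟧* a (λ a' → g (a' , b)) ⟩
    g (a , b)                            ∎
    where
    open ≡-Reasoning
    split : ∀ a' b' → χ (does (a ≟ a') ∧ does (b ≟ b')) * g (a' , b') ≡ ⟦ a ≟ a' ⟧ * (⟦ b ≟ b' ⟧ * g (a' , b'))
    split a' b' = trans (cong (_* g (a' , b')) (χ-∧ (does (a ≟ a')) (does (b ≟ b'))))
                        (ℤ.*-assoc ⟦ a ≟ a' ⟧ ⟦ b ≟ b' ⟧ (g (a' , b')))

  module _ {I : Set} (S : Summation I) where
    open Summation S

    sum-∑-comm : ∀ {n} (g : Fin n → I → ℤ) → sum (λ t → ∑ (g t)) ≡ ∑ (λ i → sum (λ t → g t i))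
    sum-∑-comm {ℕ.zero}  g = sym ∑-0
    sum-∑-comm {ℕ.suc n} g = begin
      ∑ (g zero) + sum (λ t → ∑ (g (suc t)))           ≡⟨ cong (λ z → ∑ (g zero) + z) (sum-∑-comm (g ∘ suc)) ⟩
      ∑ (g zero) + ∑ (λ i → sum (λ t → g (suc t) i))   ≡⟨ sym (∑-+ _ _) ⟩
      ∑ (λ i → sum (λ t → g t i))                      ∎
      where open ≡-Reasoning

    -- Lagrange's identity: ∑ᵢ ∑ⱼ wᵢ wⱼ (aᵢ − aⱼ)² = 2 (A C − B²).
    cauchy-schwarz : (w a : I → ℤ) → (∀ i → 0ℤ ≤ w i) →
      ∑ (λ i → w i * a i) ² ≤ ∑ w * ∑ (λ i → w i * a i ²)
    cauchy-schwarz w a 0≤w = ℤ.0≤i-j⇒j≤i (halve (subst (0ℤ ≤_) lagrange 0≤lhs))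
      where
      A = ∑ w
      B = ∑ (λ i → w i * a i)
      C = ∑ (λ i → w i * a i ²)

      0≤lhs : 0ℤ ≤ ∑ (λ i → ∑ (λ j → w i * w j * (a i - a j) ²))
      0≤lhs = 0≤∑ (λ i → 0≤∑ (λ j → 0≤x*y (0≤x*y (0≤w i) (0≤w j)) (0≤x² (a i - a j))))

      expand : ∀ wi ai wj aj → wi * wj * ((ai - aj) * (ai - aj))
             ≡ (wi * (ai * ai)) * wj + (- + 2 * (wi * ai)) * (wj * aj) + wi * (wj * (aj * aj))
      expand = solve-∀

      regroup : ∀ wa² wa w A B C → wa² * A + (- + 2 * wa) * B + w * C ≡ A * wa² + (- + 2 * B) * wa + C * w
      regroup = solve-∀

      collect : ∀ A B C → A * C + (- + 2 * B) * B + C * A ≡ (A * C - B * B) + (A * C - B * B)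
      collect = solve-∀

      inner : ∀ i → ∑ (λ j → w i * w j * (a i - a j) ²) ≡ (w i * a i ²) * A + (- + 2 * (w i * a i)) * B + w i * C
      inner i = trans (∑-cong (λ j → expand (w i) (a i) (w j) (a j)))
                      (∑-linear₃ (w i * a i ²) (- + 2 * (w i * a i)) (w i) w (λ j → w j * a j) (λ j → w j * a j ²))

      lagrange : ∑ (λ i → ∑ (λ j → w i * w j * (a i - a j) ²)) ≡ (A * C - B ²) + (A * C - B ²)
      lagrange = begin
        ∑ (λ i → ∑ (λ j → w i * w j * (a i - a j) ²))                         ≡⟨ ∑-cong inner ⟩
        ∑ (λ i → (w i * a i ²) * A + (- + 2 * (w i * a i)) * B + w i * C)
          ≡⟨ ∑-cong (λ i → regroup (w i * a i ²) (w i * a i) (w i) A B C) ⟩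
        ∑ (λ i → A * (w i * a i ²) + (- + 2 * B) * (w i * a i) + C * w i)
          ≡⟨ ∑-linear₃ A (- + 2 * B) C (λ i → w i * a i ²) (λ i → w i * a i) w ⟩
        A * C + (- + 2 * B) * B + C * A                                       ≡⟨ collect A B C ⟩
        (A * C - B ²) + (A * C - B ²)                                         ∎
        where open ≡-Reasoning

      halve : ∀ {x} → 0ℤ ≤ x + x → 0ℤ ≤ x
      halve {+ n}      _ = ℤ.+≤+ ℕ.z≤n
      halve {ℤ.-[1+ n ]} ()

    ∑²≡∑∑ : ∀ f → ∑ f ² ≡ ∑ (λ x → ∑ (λ x' → f x * f x'))
    ∑²≡∑∑ f = trans (sym (∑-*ʳ (∑ f) f)) (∑-cong (λ x → sym (∑-*ˡ (f x) f)))

    sum-∑-⟦≟⟧ : ∀ {n} (w : I → ℤ) (φ : I → Fin n) → sum (λ v → ∑ (λ x → w x * ⟦ φ x ≟ v ⟧)) ≡ ∑ w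
    sum-∑-⟦≟⟧ w φ = begin
      sum (λ v → ∑ (λ x → w x * ⟦ φ x ≟ v ⟧))  ≡⟨ sum-∑-comm (λ v x → w x * ⟦ φ x ≟ v ⟧) ⟩
      ∑ (λ x → sum (λ v → w x * ⟦ φ x ≟ v ⟧))
        ≡⟨ ∑-cong (λ x → sym (*-distribˡ-sum (w x) (λ v → ⟦ φ x ≟ v ⟧))) ⟩
      ∑ (λ x → w x * sum (λ v → ⟦ φ x ≟ v ⟧))
        ≡⟨ ∑-cong (λ x → trans (cong (w x *_) (sum-⟦≟⟧ (φ x))) (ℤ.*-identityʳ (w x))) ⟩
      ∑ w                                      ∎
      where open ≡-Reasoning

    sum-fibre² : ∀ {n} (w : I → ℤ) (φ : I → Fin n) →
      sum (λ v → ∑ (λ x → w x * ⟦ φ x ≟ v ⟧) ²) ≡ ∑ (λ x → ∑ (λ x' → w x * (w x' * ⟦ φ x' ≟ φ x ⟧)))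
    sum-fibre² {n} w φ = begin
      sum (λ v → ∑ (λ x → w x * ⟦ φ x ≟ v ⟧) ²)
        ≡⟨ sum-cong-≗ (λ v → ∑²≡∑∑ (λ x → w x * ⟦ φ x ≟ v ⟧)) ⟩
      sum (λ v → ∑ (λ x → ∑ (λ x' → (w x * ⟦ φ x ≟ v ⟧) * (w x' * ⟦ φ x' ≟ v ⟧))))
        ≡⟨ trans (sum-∑-comm (λ v x → ∑ (λ x' → term x x' v))) (∑-cong (λ x → sum-∑-comm (λ v x' → term x x' v))) ⟩
      ∑ (λ x → ∑ (λ x' → sum (λ v → (w x * ⟦ φ x ≟ v ⟧) * (w x' * ⟦ φ x' ≟ v ⟧))))
        ≡⟨ ∑-cong (λ x → ∑-cong (sift x)) ⟩
      ∑ (λ x → ∑ (λ x' → w x * (w x' * ⟦ φ x' ≟ φ x ⟧)))                    ∎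
      where
      open ≡-Reasoning
      term : I → I → Fin n → ℤ
      term x x' v = (w x * ⟦ φ x ≟ v ⟧) * (w x' * ⟦ φ x' ≟ v ⟧)
      regroup : ∀ a a' d d' → (a * d) * (a' * d') ≡ d * (a * (a' * d'))
      regroup = solve-∀
      sift : ∀ x x' → sum (term x x') ≡ w x * (w x' * ⟦ φ x' ≟ φ x ⟧)
      sift x x' = trans (sum-cong-≗ (λ v → regroup (w x) (w x') ⟦ φ x ≟ v ⟧ ⟦ φ x' ≟ v ⟧))
                        (sum-⟦≟⟧* (φ x) (λ v → w x * (w x' * ⟦ φ x' ≟ v ⟧)))

  sum-centred² : ∀ {n} (f : Fin n → ℤ) {S} → sum f ≡ S →
    sum (λ t → (+ n * f t - S) ²) ≡ + n * (+ n * sum (λ t → f t ²) - S ²)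
  sum-centred² {n} f {S} ∑f≡S = begin
    sum (λ t → (+ n * f t - S) ²)
      ≡⟨ sum-cong-≗ (λ t → expand (+ n) S (f t)) ⟩
    sum (λ t → (+ n * + n) * f t ² + (- + 2 * (+ n * S)) * f t + S ² * 1ℤ)
      ≡⟨ ∑-linear₃ (+ n * + n) (- + 2 * (+ n * S)) (S ²) (λ t → f t ²) f (λ _ → 1ℤ) ⟩
    (+ n * + n) * sum (λ t → f t ²) + (- + 2 * (+ n * S)) * sum f + S ² * sum {n} (λ _ → 1ℤ)
      ≡⟨ cong₂ (λ x y → (+ n * + n) * sum (λ t → f t ²) + (- + 2 * (+ n * S)) * x + S ² * y) ∑f≡S (sum-const n 1ℤ) ⟩
    (+ n * + n) * sum (λ t → f t ²) + (- + 2 * (+ n * S)) * S + S ² * (+ n * 1ℤ)  ≡⟨ collect (+ n) S _ ⟩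
    + n * (+ n * sum (λ t → f t ²) - S ²)                                 ∎
    where
    open ≡-Reasoning
    open Summation (finSummation n) using (∑-linear₃)
    expand : ∀ n S x → (n * x - S) * (n * x - S) ≡ (n * n) * (x * x) + (- + 2 * (n * S)) * x + (S * S) * 1ℤ
    expand = solve-∀
    collect : ∀ n S Q → (n * n) * Q + (- + 2 * (n * S)) * S + (S * S) * (n * 1ℤ) ≡ n * (n * Q - S * S)
    collect = solve-∀

  -- The bracket equals n² ∑ f² (sum-centred²), so this is Cauchy–Schwarz (∑ f)² ≤ |s| ∑ f².
  support-bound : ∀ {n} (f : Fin n → ℤ) (s : Fin n → Bool) → (∀ t → s t ≡ false → f t ≡ 0ℤ) →
    (+ n * sum f) ² ≤ sum (χ ∘ s) * (sum (λ t → (+ n * f t - sum f) ²) + + n * sum f ²)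
  support-bound {n} f s outside≡0 = begin
    (+ n * S) ²                                                ≡⟨ regroup (+ n) S ⟩
    (+ n * + n) * S ²                                          ≤⟨ *-monoˡ-≤-0≤ (0≤x² (+ n)) S²≤ ⟩
    (+ n * + n) * (sum (χ ∘ s) * sum (λ t → f t ²))             ≡⟨ swap (+ n * + n) (sum (χ ∘ s)) _ ⟩
    sum (χ ∘ s) * ((+ n * + n) * sum (λ t → f t ²))             ≡⟨ cong (sum (χ ∘ s) *_) n²∑f²≡ ⟩
    sum (χ ∘ s) * (sum (λ t → (+ n * f t - S) ²) + + n * S ²)  ∎
    where
    open ℤ.≤-Reasoning
    S = sum f
    open Summation (finSummation n) using (0≤∑)

    S²≤ : S ² ≤ sum (χ ∘ s) * sum (λ t → f t ²)
    S²≤ = begin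
      S ²                                            ≡⟨ cong _² (sum-cong-≗ f≡χf) ⟩
      sum (λ t → χ (s t) * f t) ²                    ≤⟨ cauchy-schwarz (finSummation n) (χ ∘ s) f (0≤χ ∘ s) ⟩
      sum (χ ∘ s) * sum (λ t → χ (s t) * f t ²)      ≤⟨ *-monoˡ-≤-0≤ (0≤∑ (0≤χ ∘ s)) (sum-mono χf²≤f²) ⟩
      sum (χ ∘ s) * sum (λ t → f t ²)                ∎
      where
      f≡χf : ∀ t → f t ≡ χ (s t) * f t
      f≡χf t with s t in eq
      ... | true  = sym (ℤ.*-identityˡ (f t))
      ... | false = outside≡0 t eq
      χf²≤f² : ∀ t → χ (s t) * f t ² ≤ f t ²
      χf²≤f² t = ℤ.≤-trans (*-monoʳ-≤-0≤ (0≤x² (f t)) (χ≤1 (s t))) (ℤ.≤-reflexive (ℤ.*-identityˡ _))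

    n²∑f²≡ : (+ n * + n) * sum (λ t → f t ²) ≡ sum (λ t → (+ n * f t - S) ²) + + n * S ²
    n²∑f²≡ = trans (complete (+ n) (sum (λ t → f t ²)) S) (cong (_+ + n * S ²) (sym (sum-centred² f refl)))
      where
      complete : ∀ n Q S → (n * n) * Q ≡ n * (n * Q - S * S) + n * (S * S)
      complete = solve-∀

    regroup : ∀ n S → (n * S) * (n * S) ≡ (n * n) * (S * S)
    regroup = solve-∀
    swap : ∀ a b c → a * (b * c) ≡ b * (a * c)
    swap = solve-∀

  ⟦<?⟧+⟦>?⟧ : ∀ {n} {x y : Fin n} → x ≢ y → ⟦ x <? y ⟧ + ⟦ y <? x ⟧ ≡ 1ℤ
  ⟦<?⟧+⟦>?⟧ {x = x} {y} x≢y with <-cmp x y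
  ... | tri< x<y _ _ = cong₂ (λ b b' → χ b + χ b') (dec-true (x <? y) x<y) (dec-false (y <? x) (<-asym x<y))
  ... | tri≈ _ x≡y _ = ⊥-elim (x≢y x≡y)
  ... | tri> _ _ y<x = cong₂ (λ b b' → χ b + χ b') (dec-false (x <? y) (<-asym y<x)) (dec-true (y <? x) y<x)

  -- Pair each x with σ x and count the pairs by their smaller element.
  fixedPointFree-involution⇒even : ∀ {n} (σ : Fin n → Fin n) → (∀ x → σ (σ x) ≡ x) → (∀ x → σ x ≢ x) →
    ∃ λ m → n ≡ 2 ℕ.* m
  fixedPointFree-involution⇒even {n} σ σσ≡id σx≢x =
    halve (Summation.0≤∑ (finSummation n) (λ x → 0≤χ (does (x <? σ x)))) n≡A+A
    where
    A = sum (λ x → ⟦ x <? σ x ⟧)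
    n≡A+A : + n ≡ A + A
    n≡A+A = begin
      + n
        ≡⟨ trans (sym (ℤ.*-identityʳ (+ n))) (sym (sum-const n 1ℤ)) ⟩
      sum {n} (λ _ → 1ℤ)                               ≡⟨ sum-cong-≗ (λ x → sym (⟦<?⟧+⟦>?⟧ (σx≢x x ∘ sym))) ⟩
      sum (λ x → ⟦ x <? σ x ⟧ + ⟦ σ x <? x ⟧)
        ≡⟨ ∑-distrib-+ (λ x → ⟦ x <? σ x ⟧) (λ x → ⟦ σ x <? x ⟧) ⟩
      A + sum (λ x → ⟦ σ x <? x ⟧)
        ≡⟨ cong (λ z → A + z) (sum-cong-≗ (λ x → cong (λ y → ⟦ σ x <? y ⟧) (sym (σσ≡id x)))) ⟩
      A + sum (λ x → ⟦ σ x <? σ (σ x) ⟧)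
        ≡⟨ cong (λ z → A + z) (sum-reindex σ σ σσ≡id σσ≡id (λ x → ⟦ x <? σ x ⟧)) ⟩
      A + A ∎
      where open ≡-Reasoning
    halve : ∀ {A} → 0ℤ ≤ A → + n ≡ A + A → ∃ λ m → n ≡ 2 ℕ.* m
    halve {+ m} _ eq = m , trans (ℤ.+-injective eq) (cong (m ℕ.+_) (sym (ℕ.+-identityʳ m)))

  module _ {n} (_∙_ : Fin n → Fin n → Fin n) (sum-∙ : ∀ d g → sum (λ t → g (t ∙ d)) ≡ sum g) where
    private
      module P = Summation (pointSummation n)
      module S = Summation (finSummation n)

    -- Cauchy–Schwarz in y; the translation t ↦ t ∙ y₂ then frees the sum over t from y₂.
    translates-bound : ∀ (w : Fin n × Fin n → ℤ) (G : Fin n → Fin n → ℤ) {K} →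
      (∀ y → 0ℤ ≤ w y) → (∀ c → sum (λ b → w (c , b)) ≤ K) →
      sum (λ t → P.∑ (λ y → w y * G (proj₁ y) (t ∙ proj₂ y)) ²) ≤ P.∑ w * (K * sum (λ c → sum (λ v → G c v ²)))
    translates-bound w G {K} 0≤w slice≤K = begin
      sum (λ t → P.∑ (λ y → w y * G′ t y) ²)
        ≤⟨ sum-mono (λ t → cauchy-schwarz (pointSummation n) w (G′ t) 0≤w) ⟩
      sum (λ t → P.∑ w * P.∑ (λ y → w y * G′ t y ²))
        ≡⟨ S.∑-*ˡ (P.∑ w) (λ t → P.∑ (λ y → w y * G′ t y ²)) ⟩
      P.∑ w * sum (λ t → P.∑ (λ y → w y * G′ t y ²))
        ≡⟨ cong (P.∑ w *_) (sum-∑-comm (pointSummation n) (λ t y → w y * G′ t y ²)) ⟩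
      P.∑ w * P.∑ (λ y → sum (λ t → w y * G′ t y ²))         ≡⟨ cong (P.∑ w *_) (P.∑-cong translate) ⟩
      P.∑ w * P.∑ (λ y → w y * Γ (proj₁ y))
        ≡⟨ cong (P.∑ w *_) (S.∑-cong (λ c → S.∑-*ʳ (Γ c) (λ b → w (c , b)))) ⟩
      P.∑ w * sum (λ c → sum (λ b → w (c , b)) * Γ c)
        ≤⟨ *-monoˡ-≤-0≤ (P.0≤∑ 0≤w) (sum-mono (λ c → *-monoʳ-≤-0≤ (0≤Γ c) (slice≤K c))) ⟩
      P.∑ w * sum (λ c → K * Γ c)                            ≡⟨ cong (P.∑ w *_) (S.∑-*ˡ K Γ) ⟩
      P.∑ w * (K * sum Γ)                                    ∎
      where
      open ℤ.≤-Reasoning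
      G′ : Fin n → Fin n × Fin n → ℤ
      G′ t (c , b) = G c (t ∙ b)
      Γ : Fin n → ℤ
      Γ c = sum (λ v → G c v ²)
      0≤Γ : ∀ c → 0ℤ ≤ Γ c
      0≤Γ c = S.0≤∑ (λ v → 0≤x² (G c v))
      translate : ∀ y → sum (λ t → w y * G′ t y ²) ≡ w y * Γ (proj₁ y)
      translate (c , b) = trans (S.∑-*ˡ (w (c , b)) (λ t → G′ t (c , b) ²)) (cong (w (c , b) *_) (sum-∙ b (λ v → G c v ²)))

module Counting where
  open import Data.Integer as ℤ using (+_; 1ℤ; _+_)
  import Data.Integer.Properties as ℤ
  import Data.Nat as ℕ
  import Data.Nat.Properties as ℕ
  open import Algebra.Properties.Semiring.Sum ℤ.+-*-semiring using (sum)
  import Data.Bool.Properties as Bool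
  open import Data.Bool.Properties using (T-≡)
  open import Data.Bool.ListAction using (any)
  open import Data.List.Membership.Propositional using (_∈_; lose)
  open import Data.List.Relation.Unary.Any using (here; there)
  open import Data.List.Relation.Unary.Any.Properties using (any⁺)
  import Data.List.Properties as List
  open import Function.Bundles using (module Equivalence)
  open IntegerSums using (χ)

  length-filter-tabulate : ∀ {A : Set} {n} (p : A → Bool) (f : Fin n → A) →
    + length (filter (λ x → p x Bool.≟ true) (tabulate f)) ≡ sum (λ i → χ (p (f i)))
  length-filter-tabulate {n = ℕ.zero}  p f = refl
  length-filter-tabulate {n = ℕ.suc n} p f with p (f zero)
  ... | true  = trans (ℤ.pos-+ 1 _) (cong (λ z → 1ℤ + z) (length-filter-tabulate p (f ∘ suc)))
  ... | false = trans (length-filter-tabulate p (f ∘ suc)) (sym (ℤ.+-identityˡ _))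

  length-filter-concat : ∀ {A : Set} {n} (p : A → Bool) (g : Fin n → List A) →
    + length (filter (λ x → p x Bool.≟ true) (concat (tabulate g)))
      ≡ sum (λ i → + length (filter (λ x → p x Bool.≟ true) (g i)))
  length-filter-concat {n = ℕ.zero}  p g = refl
  length-filter-concat {n = ℕ.suc n} p g = begin
    + length (filter P? (g zero ++ concat (tabulate (g ∘ suc))))
      ≡⟨ cong (λ xs → + length xs) (List.filter-++ P? (g zero) _) ⟩
    + length (filter P? (g zero) ++ filter P? (concat (tabulate (g ∘ suc))))
      ≡⟨ cong +_ (List.length-++ (filter P? (g zero))) ⟩
    + (length (filter P? (g zero)) ℕ.+ length (filter P? (concat (tabulate (g ∘ suc)))))
      ≡⟨ ℤ.pos-+ (length (filter P? (g zero))) _ ⟩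
    + length (filter P? (g zero)) + + length (filter P? (concat (tabulate (g ∘ suc))))
      ≡⟨ cong (λ z → + length (filter P? (g zero)) + z) (length-filter-concat p (g ∘ suc)) ⟩
    sum (λ i → + length (filter P? (g i)))   ∎
    where
    open ≡-Reasoning
    P? = λ x → p x Bool.≟ true

  ≤-foldr-⊔ : ∀ {m ms} → m ∈ ms → m ℕ.≤ foldr ℕ._⊔_ 0 ms
  ≤-foldr-⊔ (here refl)  = ℕ.m≤m⊔n _ _
  ≤-foldr-⊔ (there m∈ms) = ℕ.≤-trans (≤-foldr-⊔ m∈ms) (ℕ.m≤n⊔m _ _)

  any-∈ : ∀ {A : Set} {p : A → Bool} {x xs} → x ∈ xs → p x ≡ true → any p xs ≡ true
  any-∈ {p = p} x∈xs px = Equivalence.to T-≡ (any⁺ p (lose x∈xs (Equivalence.from T-≡ px)))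

module FieldProperties {q : ℕ} (F : FiniteField q) where
  open import Data.Integer as ℤ using (+_; 1ℤ; _+_; _*_; _≤_)
  import Data.Integer.Properties as ℤ
  import Data.Nat as ℕ
  open import Data.Maybe using (nothing)
  open import Function.Bundles using (_⇔_; mk⇔)
  open import Algebra.Properties.Semiring.Sum ℤ.+-*-semiring using (sum)
  open IntegerSums
  open FiniteField F

  ring : CommutativeRing _ _
  ring = record { isCommutativeRing = isCommutativeRing }

  open CommutativeRing ring using (+-group; +-assoc; +-identityʳ; *-identityˡ; *-assoc; *-comm; distribʳ; commutativeSemiring)
  open import Algebra.Properties.Group +-group using (x∙y⁻¹≈ε⇒x≈y; //-rightDividesˡ; //-rightDividesʳ; quasigroup)
  open import Algebra.Properties.Quasigroup quasigroup using (cancelˡ; cancelʳ)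
  open import Algebra.Solver.Ring.NaturalCoefficients commutativeSemiring (λ _ _ → nothing) using (solve; _:=_; _:+_; _:*_)

  _⊝_ : Fin q → Fin q → Fin q
  x ⊝ y = x ⊕ (⊖ y)

  ⊗-cancelˡ : ∀ {x y z} → x ≢ 𝟘 → x ⊗ y ≡ x ⊗ z → y ≡ z
  ⊗-cancelˡ {x} {y} {z} x≢𝟘 xy≡xz with inverse x x≢𝟘
  ... | x⁻¹ , xx⁻¹≡𝟙 = begin
    y                ≡⟨ cancel y ⟨
    x⁻¹ ⊗ (x ⊗ y)    ≡⟨ cong (x⁻¹ ⊗_) xy≡xz ⟩
    x⁻¹ ⊗ (x ⊗ z)    ≡⟨ cancel z ⟩
    z                ∎
    where
    open ≡-Reasoning
    cancel : ∀ w → x⁻¹ ⊗ (x ⊗ w) ≡ w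
    cancel w = trans (sym (*-assoc x⁻¹ x w)) (trans (cong (_⊗ w) (trans (*-comm x⁻¹ x) xx⁻¹≡𝟙)) (*-identityˡ w))

  sum-translate : ∀ d g → sum (λ t → g (t ⊕ d)) ≡ sum g
  sum-translate d = sum-reindex (_⊕ d) (_⊝ d) (//-rightDividesˡ d) (//-rightDividesʳ d)

  𝟙⊕𝟙≡𝟘⇒even : 𝟙 ⊕ 𝟙 ≡ 𝟘 → ∃ λ m → q ≡ 2 ℕ.* m
  𝟙⊕𝟙≡𝟘⇒even 𝟙⊕𝟙≡𝟘 = fixedPointFree-involution⇒even (_⊕ 𝟙) involutive no-fixed-point
    where
    involutive : ∀ x → (x ⊕ 𝟙) ⊕ 𝟙 ≡ x
    involutive x = trans (+-assoc x 𝟙 𝟙) (trans (cong (x ⊕_) 𝟙⊕𝟙≡𝟘) (+-identityʳ x))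
    no-fixed-point : ∀ x → x ⊕ 𝟙 ≢ x
    no-fixed-point x x⊕𝟙≡x = 𝟘≢𝟙 (sym (cancelˡ x 𝟙 𝟘 (trans x⊕𝟙≡x (sym (+-identityʳ x)))))

  -- level c x ≡ w iff x lies on the parabola x₂ = w − (x₁ − c)² with vertex (c , w).
  level : Fin q → Point q → Fin q
  level c (a , b) = b ⊕ ((a ⊝ c) ⊗ (a ⊝ c))

  parDist-⊕ : ∀ x y → parDist F x y ⊕ proj₂ y ≡ level (proj₁ y) x
  parDist-⊕ (a , b) (c , d) = begin
    ((b ⊝ d) ⊕ s) ⊕ d    ≡⟨ swap (b ⊝ d) s d ⟩
    ((b ⊝ d) ⊕ d) ⊕ s    ≡⟨ cong (_⊕ s) (//-rightDividesˡ d b) ⟩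
    b ⊕ s                ∎
    where
    open ≡-Reasoning
    s = (a ⊝ c) ⊗ (a ⊝ c)
    swap : ∀ x y z → (x ⊕ y) ⊕ z ≡ (x ⊕ z) ⊕ y
    swap = solve 3 (λ x y z → (x :+ y) :+ z := (x :+ z) :+ y) refl

  parDist≡⇔level≡ : ∀ x y t → parDist F x y ≡ t ⇔ level (proj₁ y) x ≡ t ⊕ proj₂ y
  parDist≡⇔level≡ x y t = mk⇔
    (λ d≡t → trans (sym (parDist-⊕ x y)) (cong (_⊕ proj₂ y) d≡t))
    (λ l≡t⊕y₂ → cancelʳ (proj₂ y) _ _ (trans (parDist-⊕ x y) l≡t⊕y₂))

  level-shift : ∀ c c' a b → level c' (a , b) ≡ level c (a , b) ⊕ ((c ⊝ c') ⊗ (((a ⊝ c) ⊕ (a ⊝ c)) ⊕ (c ⊝ c')))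
  level-shift c c' a b = begin
    b ⊕ ((a ⊝ c') ⊗ (a ⊝ c'))           ≡⟨ cong (λ v → b ⊕ (v ⊗ v)) a⊝c'≡ ⟩
    b ⊕ ((u ⊕ z) ⊗ (u ⊕ z))             ≡⟨ expand b u z ⟩
    (b ⊕ (u ⊗ u)) ⊕ (z ⊗ ((u ⊕ u) ⊕ z)) ∎
    where
    open ≡-Reasoning
    u = a ⊝ c
    z = c ⊝ c'
    a⊝c'≡ : a ⊝ c' ≡ u ⊕ z
    a⊝c'≡ = trans (cong (_⊝ c') (sym (//-rightDividesˡ c a))) (+-assoc u c (⊖ c'))
    expand : ∀ b u z → b ⊕ ((u ⊕ z) ⊗ (u ⊕ z)) ≡ (b ⊕ (u ⊗ u)) ⊕ (z ⊗ ((u ⊕ u) ⊕ z))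
    expand = solve 3 (λ b u z → b :+ (u :+ z) :* (u :+ z) := (b :+ u :* u) :+ z :* ((u :+ u) :+ z)) refl

  module _ (𝟙⊕𝟙≢𝟘 : 𝟙 ⊕ 𝟙 ≢ 𝟘) where
    level-collision : ∀ {x x'} c c' → x ≢ x' → level c x ≡ level c x' → level c' x ≡ level c' x' → c ≡ c'
    level-collision {a , b} {a' , b'} c c' x≢x' eq eq' with c ≟ c'
    ... | yes c≡c' = c≡c'
    ... | no  c≢c' = ⊥-elim (x≢x' (cong₂ _,_ a≡a' b≡b'))
      where
      z = c ⊝ c'
      u = a ⊝ c
      u' = a' ⊝ c
      shifts≡ : z ⊗ ((u ⊕ u) ⊕ z) ≡ z ⊗ ((u' ⊕ u') ⊕ z)
      shifts≡ = cancelˡ (level c (a , b)) _ _ (begin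
        level c (a , b) ⊕ (z ⊗ ((u ⊕ u) ⊕ z))      ≡⟨ level-shift c c' a b ⟨
        level c' (a , b)                          ≡⟨ eq' ⟩
        level c' (a' , b')                        ≡⟨ level-shift c c' a' b' ⟩
        level c (a' , b') ⊕ (z ⊗ ((u' ⊕ u') ⊕ z))  ≡⟨ cong (_⊕ (z ⊗ ((u' ⊕ u') ⊕ z))) eq ⟨
        level c (a , b) ⊕ (z ⊗ ((u' ⊕ u') ⊕ z))    ∎)
        where open ≡-Reasoning
      z≢𝟘 : z ≢ 𝟘
      z≢𝟘 z≡𝟘 = c≢c' (x∙y⁻¹≈ε⇒x≈y c c' z≡𝟘)
      twice : ∀ v → (𝟙 ⊕ 𝟙) ⊗ v ≡ v ⊕ v
      twice v = trans (distribʳ v 𝟙 𝟙) (cong₂ _⊕_ (*-identityˡ v) (*-identityˡ v))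
      u≡u' : u ≡ u'
      u≡u' = ⊗-cancelˡ 𝟙⊕𝟙≢𝟘 (begin
        (𝟙 ⊕ 𝟙) ⊗ u    ≡⟨ twice u ⟩
        u ⊕ u          ≡⟨ cancelʳ z (u ⊕ u) (u' ⊕ u') (⊗-cancelˡ z≢𝟘 shifts≡) ⟩
        u' ⊕ u'        ≡⟨ twice u' ⟨
        (𝟙 ⊕ 𝟙) ⊗ u'   ∎)
        where open ≡-Reasoning
      a≡a' : a ≡ a'
      a≡a' = cancelʳ (⊖ c) a a' u≡u'
      b≡b' : b ≡ b'
      b≡b' = cancelʳ (u ⊗ u) b b' (trans eq (cong (λ v → b' ⊕ (v ⊗ v)) (sym u≡u')))

    collisions≤1 : ∀ {x x'} → x ≢ x' → sum (λ c → ⟦ level c x' ≟ level c x ⟧) ≤ 1ℤ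
    collisions≤1 {x} {x'} x≢x' =
      sum-⟦≟⟧≤1 (λ c → level c x') (λ c → level c x) (λ c c' eq eq' → level-collision c c' (x≢x' ∘ sym) eq eq')

    collisions≤ : ∀ x x' → sum (λ c → ⟦ level c x' ≟ level c x ⟧) ≤ 1ℤ + ⟦ x ≟ₚ x' ⟧ * + q
    collisions≤ (a , b) (a' , b') with a ≟ a' | b ≟ b'
    ... | yes refl | yes refl = begin
      sum (λ c → ⟦ level c (a , b) ≟ level c (a , b) ⟧)
        ≤⟨ sum-mono (λ c → χ≤1 (does (level c (a , b) ≟ level c (a , b)))) ⟩
      sum {q} (λ _ → 1ℤ)                                  ≡⟨ sum-const q 1ℤ ⟩
      + q * 1ℤ                                            ≡⟨ ℤ.*-comm (+ q) 1ℤ ⟩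
      1ℤ * + q                                            ≤⟨ ℤ.i≤j+i (1ℤ * + q) 1ℤ ⟩
      1ℤ + 1ℤ * + q                                       ∎
      where open ℤ.≤-Reasoning
    ... | no a≢a' | _        = collisions≤1 (a≢a' ∘ cong proj₁)
    ... | yes _   | no b≢b'  = collisions≤1 (b≢b' ∘ cong proj₂)

module ParabolicCounting {q : ℕ} (F : FiniteField q) (E : Subset2 q) where
  open import Data.Integer as ℤ using (ℤ; +_; 0ℤ; 1ℤ; _+_; _*_; -_; _-_; _≤_)
  import Data.Integer.Properties as ℤ
  open import Data.Integer.Tactic.RingSolver using (solve-∀)
  import Data.Nat as ℕ
  import Data.Bool.Properties as Bool
  open import Data.List.Membership.Propositional using (_∈_; lose)
  open import Data.List.Membership.Propositional.Properties using (∈-allFin; ∈-map⁺; ∈-concatMap⁺; ∈-filter⁺; ∈-length)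
  import Data.List.Properties as List
  open import Relation.Nullary.Decidable using (⌊_⌋)
  open import Algebra.Properties.Semiring.Sum ℤ.+-*-semiring using (sum; sum-cong-≗)
  open IntegerSums
  open Counting
  open FiniteField F
  open FieldProperties F
  private
    module P = Summation (pointSummation q)
    module S = Summation (finSummation q)

  e : Point q → ℤ
  e x = χ (E x)

  N : ℤ
  N = P.∑ e

  pairCount : Fin q → ℤ
  pairCount t = P.∑ (λ y → e y * P.∑ (λ x → e x * ⟦ parDist F x y ≟ t ⟧))

  levelCount : Fin q → Fin q → ℤ
  levelCount c w = P.∑ (λ x → e x * ⟦ level c x ≟ w ⟧)

  0≤e : ∀ x → 0ℤ ≤ e x
  0≤e x = 0≤χ (E x)

  0≤N : 0ℤ ≤ N
  0≤N = P.0≤∑ 0≤e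

  card≡N : + card E ≡ N
  card≡N = begin
    + length (filter P? (concat (map row (allFin q))))
      ≡⟨ cong (λ rows → + length (filter P? (concat rows))) (List.map-tabulate (λ a → a) row) ⟩
    + length (filter P? (concat (tabulate row)))        ≡⟨ length-filter-concat E row ⟩
    sum (λ a → + length (filter P? (row a)))
      ≡⟨ sum-cong-≗ row-count ⟩
    N                                                   ∎
    where
    open ≡-Reasoning
    P? = λ x → E x Bool.≟ true
    row : Fin q → List (Point q)
    row a = map (λ b → (a , b)) (allFin q)
    row-count : ∀ a → + length (filter P? (row a)) ≡ sum (λ b → e (a , b))
    row-count a = trans (cong (λ xs → + length (filter P? xs)) (List.map-tabulate (λ b → b) (a ,_)))
                        (length-filter-tabulate E (a ,_))

  +card²≡N² : + (card E ℕ.^ 2) ≡ N * N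
  +card²≡N² = trans (pos-² (card E)) (cong (λ M → M * M) card≡N)

  slice≤K : ∀ c → sum (λ b → e (c , b)) ≤ + K E
  slice≤K c = subst (_≤ + K E) (length-filter-tabulate (λ b → E (c , b)) (λ b → b))
                    (ℤ.+≤+ (≤-foldr-⊔ (∈-map⁺ (sliceCard E) (∈-allFin c))))

  cardΔ≡ : + cardΔ F E ≡ sum (χ ∘ inΔ F E)
  cardΔ≡ = length-filter-tabulate (inΔ F E) (λ t → t)

  ∈-allPoints : ∀ x → x ∈ allPoints F
  ∈-allPoints (a , b) = ∈-concatMap⁺ _ (lose (∈-allFin a) (∈-map⁺ (a ,_) (∈-allFin b)))

  0<card : ∀ {x} → E x ≡ true → 0 ℕ.< card E
  0<card {x} Ex = ∈-length (∈-filter⁺ (λ y → E y Bool.≟ true) (∈-allPoints x) Ex)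

  inΔ-intro : ∀ {x y t} → E x ≡ true → E y ≡ true → parDist F x y ≡ t → inΔ F E t ≡ true
  inΔ-intro {x} {y} {t} Ex Ey d≡t = any-∈ (∈-allPoints x) (any-∈ (∈-allPoints y) witness)
    where
    witness : E x ∧ E y ∧ ⌊ parDist F x y ≟ t ⌋ ≡ true
    witness rewrite Ex | Ey with parDist F x y ≟ t
    ... | yes _   = refl
    ... | no  d≢t = ⊥-elim (d≢t d≡t)

  pairCount≡0 : ∀ t → inΔ F E t ≡ false → pairCount t ≡ 0ℤ
  pairCount≡0 t t∉Δ = trans (P.∑-cong per-y) P.∑-0
    where
    per-y : ∀ y → χ (E y) * P.∑ (λ x → χ (E x) * ⟦ parDist F x y ≟ t ⟧) ≡ 0ℤ
    per-y y with E y in Ey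
    ... | false = refl
    ... | true  = cong (1ℤ *_) (trans (P.∑-cong per-x) P.∑-0)
      where
      per-x : ∀ x → χ (E x) * ⟦ parDist F x y ≟ t ⟧ ≡ 0ℤ
      per-x x with E x in Ex | parDist F x y ≟ t
      ... | false | _       = refl
      ... | true  | no _    = refl
      ... | true  | yes d≡t with () ← trans (sym (inΔ-intro Ex Ey d≡t)) t∉Δ

  sum-pairCount : sum pairCount ≡ N * N
  sum-pairCount = begin
    sum (λ t → P.∑ (λ y → e y * P.∑ (λ x → e x * ⟦ parDist F x y ≟ t ⟧)))
      ≡⟨ sum-∑-comm (pointSummation q) (λ t y → e y * P.∑ (λ x → e x * ⟦ parDist F x y ≟ t ⟧)) ⟩
    P.∑ (λ y → sum (λ t → e y * P.∑ (λ x → e x * ⟦ parDist F x y ≟ t ⟧)))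
      ≡⟨ P.∑-cong (λ y → trans (S.∑-*ˡ (e y) (λ t → P.∑ (λ x → e x * ⟦ parDist F x y ≟ t ⟧)))
                               (cong (e y *_) (sum-∑-⟦≟⟧ (pointSummation q) e (λ x → parDist F x y)))) ⟩
    P.∑ (λ y → e y * N)
      ≡⟨ P.∑-*ʳ N e ⟩
    N * N ∎
    where open ≡-Reasoning

  pairCount≡ : ∀ t → pairCount t ≡ P.∑ (λ y → e y * levelCount (proj₁ y) (t ⊕ proj₂ y))
  pairCount≡ t = P.∑-cong (λ y → cong (e y *_) (P.∑-cong (λ x → cong (e x *_)
    (⟦⟧-cong (parDist≡⇔level≡ x y t) (parDist F x y ≟ t) (level (proj₁ y) x ≟ (t ⊕ proj₂ y))))))

  centred-pairCount≡ : ∀ t → + q * pairCount t - N * N ≡ P.∑ (λ y → e y * (+ q * levelCount (proj₁ y) (t ⊕ proj₂ y) - N))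
  centred-pairCount≡ t = sym (begin
    P.∑ (λ y → e y * (+ q * h y - N))           ≡⟨ P.∑-cong (λ y → distrib (e y) (h y) (+ q) N) ⟩
    P.∑ (λ y → + q * (e y * h y) - N * e y)     ≡⟨ P.∑-minus (λ y → + q * (e y * h y)) (λ y → N * e y) ⟩
    P.∑ (λ y → + q * (e y * h y)) - P.∑ (λ y → N * e y)
                                                ≡⟨ cong₂ _-_ (P.∑-*ˡ (+ q) (λ y → e y * h y)) (P.∑-*ˡ N e) ⟩
    + q * P.∑ (λ y → e y * h y) - N * N         ≡⟨ cong (λ z → + q * z - N * N) (sym (pairCount≡ t)) ⟩
    + q * pairCount t - N * N                   ∎)
    where
    open ≡-Reasoning
    h : Point q → ℤ
    h (c , b) = levelCount c (t ⊕ b)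
    distrib : ∀ a h q N → a * (q * h - N) ≡ q * (a * h) - N * a
    distrib = solve-∀

  sum-levelCount : ∀ c → sum (levelCount c) ≡ N
  sum-levelCount c = sum-∑-⟦≟⟧ (pointSummation q) e (level c)

  module _ (𝟙⊕𝟙≢𝟘 : 𝟙 ⊕ 𝟙 ≢ 𝟘) where

    level-energy≤ : sum (λ c → sum (λ w → levelCount c w ²)) ≤ N * N + + q * N
    level-energy≤ = begin
      sum (λ c → sum (λ w → levelCount c w ²))
        ≡⟨ sum-cong-≗ (λ c → sum-fibre² (pointSummation q) e (level c)) ⟩
      sum (λ c → P.∑ (λ x → P.∑ (λ x' → e x * (e x' * ⟦ level c x' ≟ level c x ⟧))))
        ≡⟨ trans (sum-∑-comm (pointSummation q) (λ c x → P.∑ (λ x' → term c x x')))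
                 (P.∑-cong (λ x → trans (sum-∑-comm (pointSummation q) (λ c x' → term c x x')) (P.∑-cong (pull x)))) ⟩
      P.∑ (λ x → P.∑ (λ x' → e x * (e x' * sum (λ c → ⟦ level c x' ≟ level c x ⟧))))
        ≤⟨ P.∑-mono (λ x → P.∑-mono (λ x' →
             *-monoˡ-≤-0≤ (0≤e x) (*-monoˡ-≤-0≤ (0≤e x') (collisions≤ 𝟙⊕𝟙≢𝟘 x x')))) ⟩
      P.∑ (λ x → P.∑ (λ x' → e x * (e x' * (1ℤ + ⟦ x ≟ₚ x' ⟧ * + q))))
        ≡⟨ P.∑-cong (λ x → P.∑-cong (λ x' → expand (e x) (e x') ⟦ x ≟ₚ x' ⟧ (+ q))) ⟩
      P.∑ (λ x → P.∑ (λ x' → e x * e x' + + q * (e x * (⟦ x ≟ₚ x' ⟧ * e x'))))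
        ≡⟨ P.∑-cong diagonal ⟩
      P.∑ (λ x → e x * N + + q * (e x * e x))
        ≡⟨ P.∑-+ (λ x → e x * N) (λ x → + q * (e x * e x)) ⟩
      P.∑ (λ x → e x * N) + P.∑ (λ x → + q * (e x * e x))
        ≡⟨ cong₂ _+_ (P.∑-*ʳ N e) (trans (P.∑-*ˡ (+ q) (λ x → e x * e x)) (cong (+ q *_) (P.∑-cong (χ²≡χ ∘ E)))) ⟩
      N * N + + q * N ∎
      where
      open ℤ.≤-Reasoning
      term : Fin q → Point q → Point q → ℤ
      term c x x' = e x * (e x' * ⟦ level c x' ≟ level c x ⟧)
      pull : ∀ x x' → sum (λ c → term c x x') ≡ e x * (e x' * sum (λ c → ⟦ level c x' ≟ level c x ⟧))
      pull x x' = trans (S.∑-*ˡ (e x) (λ c → e x' * ⟦ level c x' ≟ level c x ⟧))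
                        (cong (e x *_) (S.∑-*ˡ (e x') (λ c → ⟦ level c x' ≟ level c x ⟧)))
      expand : ∀ a a' d q → a * (a' * (1ℤ + d * q)) ≡ a * a' + q * (a * (d * a'))
      expand = solve-∀
      diagonal : ∀ x → P.∑ (λ x' → e x * e x' + + q * (e x * (⟦ x ≟ₚ x' ⟧ * e x'))) ≡ e x * N + + q * (e x * e x)
      diagonal x = begin-equality
        P.∑ (λ x' → e x * e x' + + q * (e x * (⟦ x ≟ₚ x' ⟧ * e x')))
          ≡⟨ P.∑-+ (λ x' → e x * e x') (λ x' → + q * (e x * (⟦ x ≟ₚ x' ⟧ * e x'))) ⟩
        P.∑ (λ x' → e x * e x') + P.∑ (λ x' → + q * (e x * (⟦ x ≟ₚ x' ⟧ * e x')))
          ≡⟨ cong₂ _+_ (P.∑-*ˡ (e x) e) (trans (P.∑-*ˡ (+ q) (λ x' → e x * (⟦ x ≟ₚ x' ⟧ * e x')))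
                 (cong (+ q *_) (trans (P.∑-*ˡ (e x) (λ x' → ⟦ x ≟ₚ x' ⟧ * e x')) (cong (e x *_) (∑ₚ-⟦≟ₚ⟧* x e))))) ⟩
        e x * N + + q * (e x * e x) ∎

    centred-level-energy≤ : sum (λ c → sum (λ w → (+ q * levelCount c w - N) ²)) ≤ + q * + q * + q * N
    centred-level-energy≤ = begin
      sum (λ c → sum (λ w → (+ q * levelCount c w - N) ²))
        ≡⟨ sum-cong-≗ (λ c → trans (sum-centred² (levelCount c) (sum-levelCount c)) (distrib (+ q) (X c) N)) ⟩
      sum (λ c → (+ q * + q) * X c - + q * N ²)
        ≡⟨ S.∑-minus (λ c → (+ q * + q) * X c) (λ _ → + q * N ²) ⟩
      sum (λ c → (+ q * + q) * X c) - sum {q} (λ _ → + q * N ²)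
        ≡⟨ cong₂ _-_ (S.∑-*ˡ (+ q * + q) X) (sum-const q (+ q * N ²)) ⟩
      (+ q * + q) * sum X - + q * (+ q * N ²)
        ≤⟨ ℤ.+-monoˡ-≤ (- (+ q * (+ q * N ²))) (*-monoˡ-≤-0≤ (0≤x² (+ q)) level-energy≤) ⟩
      (+ q * + q) * (N * N + + q * N) - + q * (+ q * N ²)
        ≡⟨ collect (+ q) N ⟩
      + q * + q * + q * N ∎
      where
      open ℤ.≤-Reasoning
      X : Fin q → ℤ
      X c = sum (λ w → levelCount c w ²)
      distrib : ∀ q X N → q * (q * X - N * N) ≡ (q * q) * X - q * (N * N)
      distrib = solve-∀
      collect : ∀ q N → (q * q) * (N * N + q * N) - q * (q * (N * N)) ≡ q * q * q * N
      collect = solve-∀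

    centred-pairCount-energy≤ : sum (λ t → (+ q * pairCount t - N * N) ²) ≤ N * (+ K E * (+ q * + q * + q * N))
    centred-pairCount-energy≤ = begin
      sum (λ t → (+ q * pairCount t - N * N) ²)
        ≡⟨ sum-cong-≗ (λ t → cong _² (centred-pairCount≡ t)) ⟩
      sum (λ t → P.∑ (λ y → e y * G (proj₁ y) (t ⊕ proj₂ y)) ²)
        ≤⟨ translates-bound _⊕_ sum-translate e G 0≤e slice≤K ⟩
      N * (+ K E * sum (λ c → sum (λ w → G c w ²)))
        ≤⟨ *-monoˡ-≤-0≤ 0≤N (*-monoˡ-≤-0≤ (ℤ.nonNegative⁻¹ (+ K E)) centred-level-energy≤) ⟩
      N * (+ K E * (+ q * + q * + q * N)) ∎
      where
      open ℤ.≤-Reasoning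
      G : Fin q → Fin q → ℤ
      G c w = + q * levelCount c w - N

    second-moment-bound : (+ q * (N * N)) ² ≤ (+ q * (N * N)) * (+ cardΔ F E * (N * N + + q * + q * + K E))
    second-moment-bound = begin
      (+ q * (N * N)) ²
        ≡⟨ cong (λ s → (+ q * s) ²) (sym sum-pairCount) ⟩
      (+ q * sum pairCount) ²
        ≤⟨ support-bound pairCount (inΔ F E) pairCount≡0 ⟩
      sum (χ ∘ inΔ F E) * (sum (λ t → (+ q * pairCount t - sum pairCount) ²) + + q * sum pairCount ²)
        ≡⟨ cong₂ (λ Δ s → Δ * (sum (λ t → (+ q * pairCount t - s) ²) + + q * s ²)) (sym cardΔ≡) sum-pairCount ⟩
      Δ * (sum (λ t → (+ q * pairCount t - N * N) ²) + + q * (N * N) ²)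
        ≤⟨ *-monoˡ-≤-0≤ (ℤ.nonNegative⁻¹ Δ) (ℤ.+-monoˡ-≤ (+ q * (N * N) ²) centred-pairCount-energy≤) ⟩
      Δ * (N * (+ K E * (+ q * + q * + q * N)) + + q * (N * N) ²)
        ≡⟨ collect Δ N (+ K E) (+ q) ⟩
      (+ q * (N * N)) * (Δ * (N * N + + q * + q * + K E)) ∎
      where
      open ℤ.≤-Reasoning
      Δ = + cardΔ F E
      collect : ∀ Δ N K q → Δ * (N * (K * (q * q * q * N)) + q * ((N * N) * (N * N))) ≡ (q * (N * N)) * (Δ * (N * N + q * q * K))
      collect = solve-∀

    cardΔ-bound : 0ℤ ℤ.< + q * (N * N) → + q * (N * N) ≤ + cardΔ F E * (N * N + + q * + q * + K E)
    cardΔ-bound 0<qN² = ℤ.*-cancelˡ-≤-pos _ _ (+ q * (N * N)) {{ℤ.positive 0<qN²}} second-moment-bound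

open import Data.Nat as ℕ using (_+_; _*_; _^_; _≤_)
open import Data.Rational using (ℚ; 0ℚ; _<_; mkℚ; ½; 1ℚ; *≤*) renaming (_*_ to _*ℚ_; _≤_ to _≤ℚ_)
import Data.Nat.Properties as ℕ
import Data.Nat.Tactic.RingSolver as ℕ-Solver
import Data.Nat.Coprimality as Coprime
open import Data.Integer as ℤ using (+_)
import Data.Integer.Properties as ℤ
import Data.Rational.Properties as ℚ

odd^ : ∀ m k → ∃ λ r → ℕ.suc (2 * m) ^ k ≡ ℕ.suc (2 * r)
odd^ m ℕ.zero    = 0 , refl
odd^ m (ℕ.suc k) with odd^ m k
... | r , eq = m + r + 2 * m * r , trans (cong (ℕ.suc (2 * m) *_) eq) (expand m r)
  where
  expand : ∀ m r → (1 + 2 * m) * (1 + 2 * r) ≡ 1 + 2 * (m + r + 2 * m * r)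
  expand = ℕ-Solver.solve-∀

oddPrimePower⇒odd : ∀ {q} → OddPrimePower q → ∃ λ r → q ≡ ℕ.suc (2 * r)
oddPrimePower⇒odd (p , k , _ , (m , refl) , refl) = odd^ m (ℕ.suc k)

oddPrimePower⇒0< : ∀ {q} → OddPrimePower q → 0 ℕ.< q
oddPrimePower⇒0< oddq with r , refl ← oddPrimePower⇒odd oddq = ℕ.z<s

oddPrimePower⇒𝟙⊕𝟙≢𝟘 : ∀ {q} → OddPrimePower q → (F : FiniteField q) → let open FiniteField F in 𝟙 ⊕ 𝟙 ≢ 𝟘
oddPrimePower⇒𝟙⊕𝟙≢𝟘 oddq F 𝟙⊕𝟙≡𝟘
  with r , q≡odd ← oddPrimePower⇒odd oddq
     | m , q≡even ← FieldProperties.𝟙⊕𝟙≡𝟘⇒even F 𝟙⊕𝟙≡𝟘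
  = ℕ.even≢odd m r (trans (sym q≡even) q≡odd)

0<n^2 : ∀ {n} → 0 ℕ.< n → 0 ℕ.< n ^ 2
0<n^2 0<n = ℕ.*-mono-< 0<n (ℕ.*-mono-< 0<n ℕ.z<s)

parabolic-distance-bound : (q : ℕ) → OddPrimePower q → (F : FiniteField q) → (E : Subset2 q) →
  Σ (Point q) (λ x → E x ≡ true) →
  q * (card E ^ 2) ≤ cardΔ F E * (card E ^ 2 + q ^ 2 * K E)
parabolic-distance-bound q oddq F E (x , Ex) =
  ℤ.drop‿+≤+ (subst₂ ℤ._≤_ (sym +qn²≡) (sym +Δ[n²+q²K]≡)
                           (cardΔ-bound (oddPrimePower⇒𝟙⊕𝟙≢𝟘 oddq F) 0<qN²))
  where
  open ParabolicCounting F E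
  +qn²≡ : + (q * card E ^ 2) ≡ + q ℤ.* (N ℤ.* N)
  +qn²≡ = trans (ℤ.pos-* q _) (cong (+ q ℤ.*_) +card²≡N²)
  +Δ[n²+q²K]≡ : + (cardΔ F E * (card E ^ 2 + q ^ 2 * K E)) ≡ + cardΔ F E ℤ.* (N ℤ.* N ℤ.+ + q ℤ.* + q ℤ.* + K E)
  +Δ[n²+q²K]≡ = trans (ℤ.pos-* (cardΔ F E) _) (cong (+ cardΔ F E ℤ.*_) (trans (ℤ.pos-+ (card E ^ 2) _)
    (cong₂ ℤ._+_ +card²≡N² (trans (ℤ.pos-* (q ^ 2) (K E)) (cong (ℤ._* + K E) (IntegerSums.pos-² q))))))
  0<qN² : ℤ.0ℤ ℤ.< + q ℤ.* (N ℤ.* N)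
  0<qN² = subst (ℤ.0ℤ ℤ.<_) +qn²≡ (ℤ.+<+ (ℕ.*-mono-< (oddPrimePower⇒0< oddq) (0<n^2 (0<card Ex))))

q*a≤d*[a+b]⇒q≤2d : ∀ {q a d b} → 0 ℕ.< a → q * a ≤ d * (a + b) → b ≤ a → q ≤ 2 * d
q*a≤d*[a+b]⇒q≤2d {q} {a} {d} {b} 0<a qa≤d[a+b] b≤a = ℕ.*-cancelʳ-≤ q (2 * d) a {{ℕ.>-nonZero 0<a}} (begin
  q * a         ≤⟨ qa≤d[a+b] ⟩
  d * (a + b)   ≤⟨ ℕ.*-monoʳ-≤ d (ℕ.+-monoʳ-≤ a b≤a) ⟩
  d * (a + a)   ≡⟨ double d a ⟩
  2 * d * a     ∎)
  where
  open ℕ.≤-Reasoning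
  double : ∀ d a → d * (a + a) ≡ 2 * d * a
  double = ℕ-Solver.solve-∀

ℕ→ℚ≡mkℚ : ∀ n → ℕ→ℚ n ≡ mkℚ (+ n) 0 (Coprime.sym (Coprime.1-coprimeTo n))
ℕ→ℚ≡mkℚ n = ℚ.normalize-coprime (Coprime.sym (Coprime.1-coprimeTo n))

ℕ→ℚ-* : ∀ m n → ℕ→ℚ m *ℚ ℕ→ℚ n ≡ ℕ→ℚ (m * n)
ℕ→ℚ-* m n = trans (cong₂ _*ℚ_ (ℕ→ℚ≡mkℚ m) (ℕ→ℚ≡mkℚ n)) (ℚ./-cong {q₁ = 1} {q₂ = 1} (ℤ.+◃n≡+n (m * n)) refl)

ℕ→ℚ-mono-≤ : ∀ {m n} → m ≤ n → ℕ→ℚ m ≤ℚ ℕ→ℚ n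
ℕ→ℚ-mono-≤ {m} {n} m≤n rewrite ℕ→ℚ≡mkℚ m | ℕ→ℚ≡mkℚ n =
  *≤* (subst₂ ℤ._≤_ (sym (ℤ.*-identityʳ (+ m))) (sym (ℤ.*-identityʳ (+ n))) (ℤ.+≤+ m≤n))

ℕ→ℚ-cancel-≤ : ∀ {m n} → ℕ→ℚ m ≤ℚ ℕ→ℚ n → m ≤ n
ℕ→ℚ-cancel-≤ {m} {n} m≤n rewrite ℕ→ℚ≡mkℚ m | ℕ→ℚ≡mkℚ n =
  ℤ.drop‿+≤+ (subst₂ ℤ._≤_ (ℤ.*-identityʳ (+ m)) (ℤ.*-identityʳ (+ n)) (ℚ.drop-*≤* m≤n))

½*ℕ→ℚ-≤ : ∀ {m n} → m ≤ 2 * n → ½ *ℚ ℕ→ℚ m ≤ℚ ℕ→ℚ n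
½*ℕ→ℚ-≤ {m} {n} m≤2n = begin
  ½ *ℚ ℕ→ℚ m              ≤⟨ ℚ.*-monoˡ-≤-nonNeg ½ (ℕ→ℚ-mono-≤ m≤2n) ⟩
  ½ *ℚ ℕ→ℚ (2 * n)        ≡⟨ cong (½ *ℚ_) (sym (ℕ→ℚ-* 2 n)) ⟩
  ½ *ℚ (ℕ→ℚ 2 *ℚ ℕ→ℚ n)   ≡⟨ sym (ℚ.*-assoc ½ (ℕ→ℚ 2) (ℕ→ℚ n)) ⟩
  1ℚ *ℚ ℕ→ℚ n             ≡⟨ ℚ.*-identityˡ (ℕ→ℚ n) ⟩
  ℕ→ℚ n                   ∎
  where open ℚ.≤-Reasoning

large-set-bound : (q : ℕ) → OddPrimePower q → (F : FiniteField q) → (E : Subset2 q) →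
  Σ (Point q) (λ x → E x ≡ true) →
  (1ℚ *ℚ 1ℚ) *ℚ (ℕ→ℚ (q ^ 2) *ℚ ℕ→ℚ (K E)) ≤ℚ ℕ→ℚ (card E ^ 2) →
  ½ *ℚ ℕ→ℚ q ≤ℚ ℕ→ℚ (cardΔ F E)
large-set-bound q oddq F E (x , Ex) large = ½*ℕ→ℚ-≤ {q} {cardΔ F E}
  (q*a≤d*[a+b]⇒q≤2d {d = cardΔ F E} (0<n^2 (ParabolicCounting.0<card F E Ex))
                                     (parabolic-distance-bound q oddq F E (x , Ex)) q²K≤n²)
  where
  q²K≤n² : q ^ 2 * K E ≤ card E ^ 2
  q²K≤n² = ℕ→ℚ-cancel-≤ (subst (_≤ℚ ℕ→ℚ (card E ^ 2))
                               (trans (ℚ.*-identityˡ _) (ℕ→ℚ-* (q ^ 2) (K E))) large)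

theorem1p2 : ((q : ℕ) → OddPrimePower q → (F : FiniteField q) → (E : Subset2 q) →
    Σ (Point q) (λ x → E x ≡ true) →
    q * (card E ^ 2) ≤ cardΔ F E * (card E ^ 2 + q ^ 2 * K E))
    ×
    Σ ℚ (λ C → Σ ℚ (λ c → 0ℚ < C × 0ℚ < c ×
    ((q : ℕ) → OddPrimePower q → (F : FiniteField q) → (E : Subset2 q) →
    Σ (Point q) (λ x → E x ≡ true) →
    (C *ℚ C) *ℚ (ℕ→ℚ (q ^ 2) *ℚ ℕ→ℚ (K E)) ≤ℚ ℕ→ℚ (card E ^ 2) →
    c *ℚ ℕ→ℚ q ≤ℚ ℕ→ℚ (cardΔ F E))))
theorem1p2 = parabolic-distance-bound , 1ℚ , ½ , ℚ.positive⁻¹ 1ℚ , ℚ.positive⁻¹ ½ , large-set-bound
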